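{- In the $F_3$ Black Hole Zeckendorf game, the position $(a,0)$ is a $P$ position whenever $a\equiv 0,1\pmod 3$, and the position $(0,b)$ is a $P$ position whenever $b\equiv 0,1\pmod 3$ (with $a,b\in\mathbb{Z}_{\ge0}$).
   Context: The $F_3$ Black Hole Zeckendorf game: a position is a pair $(a,b)$ of nonnegative integers, the numbers of pieces in the columns of weight $F_1=1$ and $F_2=2$. Two players alternate moves; the available moves are: (merge) if $a\ge 2$, go to $(a-2,b+1)$; (add) if $a\ge1,b\ge1$, go to $(a-1,b-1)$; (split) if $b\ge 2$, go to $(a+1,b-2)$ (pieces landing in column $F_3$, the "black hole", are removed). The player making the last move wins. A position is a $P$ position if the player to move from it loses under optimal play, and an $N$ position if the player to move can force a win; positions with no move are $P$ positions. -}

module Defs where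

open import Data.Nat using (ℕ; zero; suc)
open import Data.Product using (_×_; _,_; Σ)

-- A position (a , b): a pieces in column F₁ = 1, b pieces in column F₂ = 2.
Position : Set
Position = ℕ × ℕ

data Move : Position → Position → Set where
  merge : ∀ a b → Move (suc (suc a) , b) (a , suc b)
  -- add:   (a+1, b+1) → (a, b)   (the new F₃ piece falls into the black hole)
  add   : ∀ a b → Move (suc a , suc b) (a , b)
  -- split: (a, b+2) → (a+1, b)   (the F₃ piece falls into the black hole)
  split : ∀ a b → Move (a , suc (suc b)) (suc a , b)

mutual
  data IsP (p : Position) : Set where
    allN : (∀ q → Move p q → IsN q) → IsP p

  data IsN (p : Position) : Set where
    someP : ∀ q → Move p q → IsP q → IsN p

{-# OPTIONS --safe #-}
-- Modulo 3, merge (−2 , +1) and split (+1 , −2) shift the residue pair of (a , b) by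
-- (1 , 1), and add shifts it by (2 , 2). So a move keeps the pair on its diagonal
-- {(x + k , y + k)} but never fixes it, and each of the three diagonals contains exactly
-- one cold pair (0 , 0), (0 , 1), (1 , 0). Hence no move joins two cold positions, while
-- from a hot position the move to the cold pair of its diagonal is available. As moves
-- decrease a + b, the cold positions are then exactly the P positions.
module Submission where

open import Defs
open import Data.Empty using (⊥-elim)
open import Data.Nat using (ℕ; zero; suc; _+_; _<_; _%_; s≤s)
open import Data.Nat.Induction using (<-wellFounded)
open import Data.Nat.Properties using (+-suc; +-monoʳ-<; n<1+n; ≤-reflexive; m<n⇒m<1+n)
open import Data.Product using (_×_; _,_; -,_; proj₁; proj₂; ∃-syntax)
open import Data.Sum using (_⊎_; inj₁; inj₂)
open import Function using (flip)
open import Induction.WellFounded using (WellFounded; Acc; acc; module Subrelation)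
open import Relation.Binary.Construct.On using (wellFounded)
open import Relation.Binary.PropositionalEquality using (_≡_; refl; sym; trans; cong; subst)
open import Relation.Nullary using (¬_)

pieces : Position → ℕ
pieces (a , b) = a + b

move-decreases-pieces : ∀ {p q} → Move p q → pieces q < pieces p
move-decreases-pieces (merge a b) = s≤s (≤-reflexive (+-suc a b))
move-decreases-pieces (add a b)   = m<n⇒m<1+n (+-monoʳ-< a (n<1+n b))
move-decreases-pieces (split a b) = ≤-reflexive (sym (trans (+-suc a (suc b)) (cong suc (+-suc a b))))

moves-wellFounded : WellFounded (flip Move)
moves-wellFounded =
  Subrelation.wellFounded move-decreases-pieces (wellFounded pieces <-wellFounded)

module Kernel
  (K : Position → Set)
  (independent : ∀ {p q} → K p → Move p q → ¬ K q)
  (absorbing : ∀ {p} → ¬ K p → ∃[ q ] Move p q × K q)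
  where

  mutual
    kernel⇒P : ∀ {p} → Acc (flip Move) p → K p → IsP p
    kernel⇒P (acc rs) k = allN λ q m → outside⇒N (rs m) (independent k m)

    outside⇒N : ∀ {p} → Acc (flip Move) p → ¬ K p → IsN p
    outside⇒N (acc rs) ¬k with absorbing ¬k
    ... | q , m , k = someP q m (kernel⇒P (rs m) k)

data Residue : Set where
  r₀ r₁ r₂ : Residue

next : Residue → Residue
next r₀ = r₁
next r₁ = r₂
next r₂ = r₀

next³ : ∀ x → next (next (next x)) ≡ x
next³ r₀ = refl
next³ r₁ = refl
next³ r₂ = refl

residue : ℕ → Residue
residue zero    = r₀
residue (suc n) = next (residue n)

toℕ : Residue → ℕ
toℕ r₀ = 0
toℕ r₁ = 1
toℕ r₂ = 2

toℕ-residue : ∀ n → toℕ (residue n) ≡ n % 3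
toℕ-residue 0 = refl
toℕ-residue 1 = refl
toℕ-residue 2 = refl
toℕ-residue (suc (suc (suc n))) = trans (cong toℕ (next³ (residue n))) (toℕ-residue n)

data ColdPair : Residue → Residue → Set where
  cold₀₀ : ColdPair r₀ r₀
  cold₀₁ : ColdPair r₀ r₁
  cold₁₀ : ColdPair r₁ r₀

cold⇒next-hot : ∀ {x y} → ColdPair x y → ¬ ColdPair (next x) (next y)
cold⇒next-hot cold₀₀ ()
cold⇒next-hot cold₀₁ ()
cold⇒next-hot cold₁₀ ()

diagonal-cold : ∀ x y → ColdPair x y
                      ⊎ ColdPair (next x) (next y)
                      ⊎ ColdPair (next (next x)) (next (next y))
diagonal-cold r₀ r₀ = inj₁ cold₀₀
diagonal-cold r₀ r₁ = inj₁ cold₀₁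
diagonal-cold r₀ r₂ = inj₂ (inj₁ cold₁₀)
diagonal-cold r₁ r₀ = inj₁ cold₁₀
diagonal-cold r₁ r₁ = inj₂ (inj₂ cold₀₀)
diagonal-cold r₁ r₂ = inj₂ (inj₂ cold₀₁)
diagonal-cold r₂ r₀ = inj₂ (inj₁ cold₀₁)
diagonal-cold r₂ r₁ = inj₂ (inj₂ cold₁₀)
diagonal-cold r₂ r₂ = inj₂ (inj₁ cold₀₀)

Cold : Position → Set
Cold (a , b) = ColdPair (residue a) (residue b)

cold-moves-to-hot : ∀ {p q} → Cold p → Move p q → ¬ Cold q
cold-moves-to-hot c (merge a b) c′ =
  cold⇒next-hot c (subst (λ x → ColdPair x _) (sym (next³ (residue a))) c′)
cold-moves-to-hot c (add a b) c′ = cold⇒next-hot c′ c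
cold-moves-to-hot c (split a b) c′ =
  cold⇒next-hot c (subst (ColdPair _) (sym (next³ (residue b))) c′)

hot-moves-to-cold : ∀ {p} → ¬ Cold p → ∃[ q ] Move p q × Cold q
hot-moves-to-cold {0 , 0} hot = ⊥-elim (hot cold₀₀)
hot-moves-to-cold {0 , 1} hot = ⊥-elim (hot cold₀₁)
hot-moves-to-cold {1 , 0} hot = ⊥-elim (hot cold₁₀)
hot-moves-to-cold {0 , suc (suc b)} hot with diagonal-cold r₁ (residue b)
... | inj₁ c = -, split 0 b , c
... | inj₂ (inj₂ c) = ⊥-elim (hot c)
hot-moves-to-cold {1 , suc b} hot with diagonal-cold r₀ (residue b)
... | inj₁ c = -, add 0 b , c
... | inj₂ (inj₁ c) = ⊥-elim (hot c)
hot-moves-to-cold {suc (suc a) , 0} hot with diagonal-cold (residue a) r₁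
... | inj₁ c = -, merge a 0 , c
... | inj₂ (inj₂ c) = ⊥-elim (hot c)
hot-moves-to-cold {suc (suc a) , suc b} hot with diagonal-cold (next (residue a)) (residue b)
... | inj₁ c = -, add (suc a) b , c
... | inj₂ (inj₁ c) = ⊥-elim (hot c)
... | inj₂ (inj₂ c) = -, merge a (suc b) , subst (λ x → ColdPair x _) (next³ (residue a)) c

open Kernel Cold cold-moves-to-hot hot-moves-to-cold

cold⇒P : ∀ p → Cold p → IsP p
cold⇒P p = kernel⇒P (moves-wellFounded p)

low-residue⇒cold : ∀ {x} → toℕ x ≡ 0 ⊎ toℕ x ≡ 1 → ColdPair x r₀ × ColdPair r₀ x
low-residue⇒cold {r₀} _ = cold₀₀ , cold₀₀
low-residue⇒cold {r₁} _ = cold₁₀ , cold₀₁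
low-residue⇒cold {r₂} (inj₁ ())
low-residue⇒cold {r₂} (inj₂ ())

theorem4p1 : (∀ (a : ℕ) → (a % 3 ≡ 0 ⊎ a % 3 ≡ 1) → IsP (a , 0))
    × (∀ (b : ℕ) → (b % 3 ≡ 0 ⊎ b % 3 ≡ 1) → IsP (0 , b))
theorem4p1 = (λ a h → cold⇒P (a , 0) (proj₁ (column a h)))
           , (λ b h → cold⇒P (0 , b) (proj₂ (column b h)))
  where
  column : ∀ n → n % 3 ≡ 0 ⊎ n % 3 ≡ 1 → ColdPair (residue n) r₀ × ColdPair r₀ (residue n)
  column n h = low-residue⇒cold (subst (λ m → m ≡ 0 ⊎ m ≡ 1) (sym (toℕ-residue n)) h)
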